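{- Let $n\geq 2$, let $M_n=\{1,2,\dots,n\}$, and let $\mathcal{F}\subset 2^{M_n}$ be a family of subsets of $M_n$ that is union-closed (i.e. $A\cup B\in\mathcal{F}$ for all $A,B\in\mathcal{F}$) and satisfies $\bigcup_{A\in\mathcal{F}}A=M_n$. Fix $i\in M_n$ and $j\in M_n\setminus\{i\}$. Define the family $\mathcal{G}=\{A\setminus\{i\}: A\in\mathcal{F}\}$, and set $\mathcal{G}_j=\{A\in\mathcal{G}: j\in A\}$ and $\mathcal{F}_j=\{A\in\mathcal{F}: j\in A\}$. If $\frac{|\mathcal{G}_j|}{|\mathcal{G}|}\geq c$ for some constant $c\in(0,1]$, then $$\frac{|\mathcal{F}_j|}{|\mathcal{F}|}\geq \frac{1}{1+2(1-c)/c}.$$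
   Context: $|X|$ denotes the cardinality of a set $X$. $\mathcal{G}$ is a set of subsets (so sets $A\setminus\{i\}$ arising from different $A\in\mathcal{F}$ are counted once).
   Formalization: The constant $c\in(0,1]$ is taken rational, ranging over ℚ. -}

module Defs where

open import Data.Nat using (ℕ)
open import Data.Fin using (Fin)
open import Data.Fin.Subset using (Subset; _∪_; _-_; _∈_)
open import Data.Fin.Subset.Properties using (_∈?_)
open import Data.List using (List; length; map; filter; deduplicate)
open import Data.List.Membership.Propositional renaming (_∈_ to _∈ˡ_)
open import Data.List.Relation.Unary.Unique.Propositional using (Unique)
open import Data.Product using (∃; _×_)
open import Data.Bool.Properties renaming (_≟_ to _≟ᵇ_)
open import Data.Vec.Properties using (≡-dec)
open import Data.Integer using (+_)
open import Data.Rational using (ℚ; _/_)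
open import Relation.Binary.PropositionalEquality using (_≡_)

-- A family of subsets of M_n = Fin n, given as a duplicate-free list,
-- so that its cardinality is the length of the list.
Family : ℕ → Set
Family n = List (Subset n)

_∈𝓕_ : ∀ {n} → Subset n → Family n → Set
A ∈𝓕 𝓕 = A ∈ˡ 𝓕

card : ∀ {n} → Family n → ℕ
card = length

UnionClosed : ∀ {n} → Family n → Set
UnionClosed 𝓕 = ∀ {A B} → A ∈𝓕 𝓕 → B ∈𝓕 𝓕 → (A ∪ B) ∈𝓕 𝓕

CoversGround : ∀ {n} → Family n → Set
CoversGround {n} 𝓕 = ∀ (x : Fin n) → ∃ λ A → A ∈𝓕 𝓕 × x ∈ A

removeElt : ∀ {n} → Fin n → Family n → Family n
removeElt i 𝓕 = deduplicate (≡-dec _≟ᵇ_) (map (λ A → A - i) 𝓕)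

containing : ∀ {n} → Fin n → Family n → Family n
containing j 𝓕 = filter (λ A → j ∈? A) 𝓕

ℕ→ℚ : ℕ → ℚ
ℕ→ℚ k = + k / 1

-- Every set of 𝓖 containing j is A ∖ {i} for some A ∈ 𝓕 containing j,
-- so |𝓖_j| ≤ |𝓕_j|; and a set A ∈ 𝓕 avoiding j is either B or B ∪ {i} for
-- B = A ∖ {i} ∈ 𝓖 avoiding j, so |𝓕 ∖ 𝓕_j| ≤ 2 |𝓖 ∖ 𝓖_j|. The hypothesis
-- c |𝓖| ≤ |𝓖_j| reads c |𝓖 ∖ 𝓖_j| ≤ (1 - c) |𝓖_j|, hence
-- c |𝓕| ≤ c |𝓕_j| + 2c |𝓖 ∖ 𝓖_j| ≤ (c + 2(1 - c)) |𝓕_j|.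
module Submission where

open import Defs
open import Data.Nat as ℕ using (ℕ; _≥_; suc; z≤n; s≤s)
import Data.Nat.Properties as ℕ
open import Data.Integer as ℤ using (+_)
import Data.Integer.Properties as ℤ
open import Data.Nat.Coprimality as Coprimality using (1-coprimeTo)
open import Data.Fin using (Fin; zero; suc)
open import Data.Fin.Subset using (Subset; _∪_; ⁅_⁆; _∈_; _∉_; inside; outside)
  renaming (_-_ to _∖_)
open import Data.Fin.Subset.Properties using (_∈?_; p─⊥≡p; p─q⊆p; ∪-identityʳ)
open import Data.Vec using (_∷_; here; there)
open import Data.List using (List; []; _∷_; length; map; filter; _++_)
open import Data.List.Properties using (length-++; length-map)
open import Data.List.Membership.Propositional using () renaming (_∈_ to _∈ˡ_)
open import Data.List.Membership.Propositional.Properties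
  using (∈-∃++; ∈-++⁺ˡ; ∈-++⁺ʳ; ∈-++⁻; ∈-map⁺; ∈-map⁻; ∈-filter⁺; ∈-filter⁻; ∈-deduplicate⁺; ∈-deduplicate⁻)
open import Data.List.Relation.Binary.Subset.Propositional using (_⊆_)
open import Data.List.Relation.Unary.Any using (here; there)
open import Data.List.Relation.Unary.All as All using ()
open import Data.List.Relation.Unary.AllPairs using (_∷_)
open import Data.List.Relation.Unary.Unique.Propositional using (Unique)
open import Data.List.Relation.Unary.Unique.Propositional.Properties using (filter⁺)
open import Data.List.Relation.Unary.Unique.DecPropositional.Properties using (deduplicate-!)
open import Data.Bool.Properties using () renaming (_≟_ to _≟ᵇ_)
open import Data.Vec.Properties using (≡-dec)
open import Data.Product using (_,_)
open import Data.Sum using (inj₁; inj₂)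
open import Data.Rational using (ℚ; mkℚ; _/_; 0ℚ; 1ℚ; _+_; _-_; -_; _*_; _<_; _≤_; *≤*; nonNegative)
open import Data.Rational.Properties
  using (normalize-coprime; ≤-trans; ≤-reflexive; <⇒≤; +-monoˡ-≤; +-monoʳ-≤; +-mono-≤; *-monoˡ-≤-nonNeg; +-inverseʳ; module ≤-Reasoning)
open import Data.Rational.Solver using (module +-*-Solver)
open import Function using (_∘_)
open import Relation.Nullary using (yes; no; contradiction)
open import Relation.Unary using (Decidable)
open import Relation.Unary.Properties using (∁?)
open import Relation.Binary.PropositionalEquality using (_≡_; _≢_; refl; sym; trans; cong; cong₂; subst; subst₂; module ≡-Reasoning)

private
  variable
    n : ℕ

x∉p⇒p∖x≡p : {x : Fin n} {p : Subset n} → x ∉ p → p ∖ x ≡ p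
x∉p⇒p∖x≡p {x = zero}  {outside ∷ p} _   = cong (outside ∷_) (p─⊥≡p p)
x∉p⇒p∖x≡p {x = zero}  {inside ∷ p}  x∉p = contradiction here x∉p
x∉p⇒p∖x≡p {x = suc x} {b ∷ p}       x∉p = cong (b ∷_) (x∉p⇒p∖x≡p (x∉p ∘ there))

x∈p⇒p∖x∪⁅x⁆≡p : {x : Fin n} {p : Subset n} → x ∈ p → (p ∖ x) ∪ ⁅ x ⁆ ≡ p
x∈p⇒p∖x∪⁅x⁆≡p {x = zero}  {inside ∷ p}  here        = cong (inside ∷_) (trans (∪-identityʳ _) (p─⊥≡p p))
x∈p⇒p∖x∪⁅x⁆≡p {x = suc x} {inside ∷ p}  (there x∈p) = cong (inside ∷_) (x∈p⇒p∖x∪⁅x⁆≡p x∈p)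
x∈p⇒p∖x∪⁅x⁆≡p {x = suc x} {outside ∷ p} (there x∈p) = cong (outside ∷_) (x∈p⇒p∖x∪⁅x⁆≡p x∈p)

module _ {a} {A : Set a} where

  unique⇒length-mono-⊆ : {xs ys : List A} → Unique xs → xs ⊆ ys → length xs ℕ.≤ length ys
  unique⇒length-mono-⊆ {[]}     _             _     = z≤n
  unique⇒length-mono-⊆ {x ∷ xs} (x∉xs ∷ uxs) xs⊆ys with ∈-∃++ (xs⊆ys (here refl))
  ... | us , vs , refl = ℕ.≤-trans (s≤s (unique⇒length-mono-⊆ uxs xs⊆us++vs)) (ℕ.≤-reflexive length-insert)
    where
    xs⊆us++vs : xs ⊆ us ++ vs
    xs⊆us++vs y∈xs with ∈-++⁻ us (xs⊆ys (there y∈xs))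
    ... | inj₁ y∈us          = ∈-++⁺ˡ y∈us
    ... | inj₂ (here y≡x)    = contradiction (sym y≡x) (All.lookup x∉xs y∈xs)
    ... | inj₂ (there y∈vs)  = ∈-++⁺ʳ us y∈vs

    length-insert : suc (length (us ++ vs)) ≡ length (us ++ x ∷ vs)
    length-insert = begin
      suc (length (us ++ vs))          ≡⟨ cong suc (length-++ us) ⟩
      suc (length us ℕ.+ length vs)    ≡⟨ ℕ.+-suc (length us) (length vs) ⟨
      length us ℕ.+ length (x ∷ vs)    ≡⟨ length-++ us ⟨
      length (us ++ x ∷ vs)            ∎
      where open ≡-Reasoning

  length-filter-∁ : ∀ {p} {P : A → Set p} (P? : Decidable P) (xs : List A) →
                    length xs ≡ length (filter P? xs) ℕ.+ length (filter (∁? P?) xs)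
  length-filter-∁ P? []       = refl
  length-filter-∁ P? (x ∷ xs) with P? x
  ... | yes _ = cong suc (length-filter-∁ P? xs)
  ... | no  _ = trans (cong suc (length-filter-∁ P? xs)) (sym (ℕ.+-suc _ _))

avoiding : Fin n → Family n → Family n
avoiding j 𝓕 = filter (∁? (j ∈?_)) 𝓕

card≡containing+avoiding : (j : Fin n) (𝓕 : Family n) →
                           card 𝓕 ≡ card (containing j 𝓕) ℕ.+ card (avoiding j 𝓕)
card≡containing+avoiding j = length-filter-∁ (j ∈?_)

module _ (i j : Fin n) where

  card-containing-removeElt≤ : (𝓕 : Family n) →
                               card (containing j (removeElt i 𝓕)) ℕ.≤ card (containing j 𝓕)
  card-containing-removeElt≤ 𝓕 = ℕ.≤-trans
    (unique⇒length-mono-⊆ (filter⁺ (j ∈?_) (deduplicate-! (≡-dec _≟ᵇ_) (map (_∖ i) 𝓕))) 𝓖ⱼ⊆𝓕ⱼ∖i)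
    (ℕ.≤-reflexive (length-map (_∖ i) (containing j 𝓕)))
    where
    𝓖ⱼ⊆𝓕ⱼ∖i : containing j (removeElt i 𝓕) ⊆ map (_∖ i) (containing j 𝓕)
    𝓖ⱼ⊆𝓕ⱼ∖i B∈𝓖ⱼ with ∈-filter⁻ (j ∈?_) B∈𝓖ⱼ
    ... | B∈𝓖 , j∈B with ∈-map⁻ (_∖ i) (∈-deduplicate⁻ (≡-dec _≟ᵇ_) (map (_∖ i) 𝓕) B∈𝓖)
    ... | A , A∈𝓕 , refl = ∈-map⁺ (_∖ i) (∈-filter⁺ (j ∈?_) A∈𝓕 (p─q⊆p _ ⁅ i ⁆ j∈B))

  card-avoiding≤card-avoiding-removeElt-twice : (𝓕 : Family n) → Unique 𝓕 →
    card (avoiding j 𝓕) ℕ.≤ card (avoiding j (removeElt i 𝓕)) ℕ.+ card (avoiding j (removeElt i 𝓕))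
  card-avoiding≤card-avoiding-removeElt-twice 𝓕 unique = ℕ.≤-trans
    (unique⇒length-mono-⊆ (filter⁺ _ unique) 𝓕ₙ⊆𝓖ₙ++𝓖ₙ∪i)
    (ℕ.≤-reflexive (trans (length-++ 𝓖ₙ) (cong (card 𝓖ₙ ℕ.+_) (length-map (_∪ ⁅ i ⁆) 𝓖ₙ))))
    where
    𝓖ₙ : Family n
    𝓖ₙ = avoiding j (removeElt i 𝓕)

    A∖i∈𝓖ₙ : ∀ {A} → A ∈ˡ avoiding j 𝓕 → A ∖ i ∈ˡ 𝓖ₙ
    A∖i∈𝓖ₙ {A} A∈𝓕ₙ with ∈-filter⁻ (∁? (j ∈?_)) {xs = 𝓕} A∈𝓕ₙ
    ... | A∈𝓕 , j∉A = ∈-filter⁺ (∁? (j ∈?_))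
      (∈-deduplicate⁺ (≡-dec _≟ᵇ_) (∈-map⁺ (_∖ i) A∈𝓕)) (j∉A ∘ p─q⊆p A ⁅ i ⁆)

    𝓕ₙ⊆𝓖ₙ++𝓖ₙ∪i : avoiding j 𝓕 ⊆ 𝓖ₙ ++ map (_∪ ⁅ i ⁆) 𝓖ₙ
    𝓕ₙ⊆𝓖ₙ++𝓖ₙ∪i {A} A∈𝓕ₙ with i ∈? A
    ... | yes i∈A = ∈-++⁺ʳ 𝓖ₙ (subst (_∈ˡ map (_∪ ⁅ i ⁆) 𝓖ₙ) (x∈p⇒p∖x∪⁅x⁆≡p i∈A) (∈-map⁺ (_∪ ⁅ i ⁆) (A∖i∈𝓖ₙ A∈𝓕ₙ)))
    ... | no  i∉A = ∈-++⁺ˡ (subst (_∈ˡ 𝓖ₙ) (x∉p⇒p∖x≡p i∉A) (A∖i∈𝓖ₙ A∈𝓕ₙ))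

ℕ→ℚ≡mkℚ : ∀ k → ℕ→ℚ k ≡ mkℚ (+ k) 0 (Coprimality.sym (1-coprimeTo k))
ℕ→ℚ≡mkℚ k = normalize-coprime (Coprimality.sym (1-coprimeTo k))

ℕ→ℚ-homo-+ : ∀ a b → ℕ→ℚ (a ℕ.+ b) ≡ ℕ→ℚ a + ℕ→ℚ b
ℕ→ℚ-homo-+ a b rewrite ℕ→ℚ≡mkℚ a | ℕ→ℚ≡mkℚ b =
  cong (_/ 1) (sym (cong₂ ℤ._+_ (ℤ.*-identityʳ (+ a)) (ℤ.*-identityʳ (+ b))))

ℕ→ℚ-mono-≤ : ∀ {a b} → a ℕ.≤ b → ℕ→ℚ a ≤ ℕ→ℚ b
ℕ→ℚ-mono-≤ {a} {b} a≤b rewrite ℕ→ℚ≡mkℚ a | ℕ→ℚ≡mkℚ b =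
  *≤* (subst₂ ℤ._≤_ (sym (ℤ.*-identityʳ (+ a))) (sym (ℤ.*-identityʳ (+ b))) (ℤ.+≤+ a≤b))

module _ {c : ℚ} where
  open +-*-Solver using (solve; _:+_; _:*_; _:-_; _:=_; con)
  open ≤-Reasoning

  c*y≤[1-c]*x : ∀ {x y} → c * (x + y) ≤ x → c * y ≤ (1ℚ - c) * x
  c*y≤[1-c]*x {x} {y} c[x+y]≤x = begin
    c * y                  ≡⟨ solve 3 (λ c x y → c :* y := c :* (x :+ y) :- c :* x) refl c x y ⟩
    c * (x + y) - c * x    ≤⟨ +-monoˡ-≤ (- (c * x)) c[x+y]≤x ⟩
    x - c * x              ≡⟨ solve 2 (λ c x → x :- c :* x := (con 1ℚ :- c) :* x) refl c x ⟩
    (1ℚ - c) * x           ∎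

  density-transfer : ∀ {fⱼ fₙ gⱼ gₙ} → 0ℚ ≤ c → c ≤ 1ℚ →
                     fₙ ≤ gₙ + gₙ → gⱼ ≤ fⱼ → c * (gⱼ + gₙ) ≤ gⱼ →
                     c * (fⱼ + fₙ) ≤ (c + (1ℚ + 1ℚ) * (1ℚ - c)) * fⱼ
  density-transfer {fⱼ} {fₙ} {gⱼ} {gₙ} 0≤c c≤1 fₙ≤2gₙ gⱼ≤fⱼ c[gⱼ+gₙ]≤gⱼ = begin
    c * (fⱼ + fₙ)
      ≤⟨ *-monoˡ-≤-nonNeg c {{nonNegative 0≤c}} (+-monoʳ-≤ fⱼ fₙ≤2gₙ) ⟩
    c * (fⱼ + (gₙ + gₙ))
      ≡⟨ solve 3 (λ c f g → c :* (f :+ (g :+ g)) := c :* f :+ (c :* g :+ c :* g)) refl c fⱼ gₙ ⟩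
    c * fⱼ + (c * gₙ + c * gₙ)
      ≤⟨ +-monoʳ-≤ (c * fⱼ) (+-mono-≤ c*gₙ≤[1-c]*fⱼ c*gₙ≤[1-c]*fⱼ) ⟩
    c * fⱼ + ((1ℚ - c) * fⱼ + (1ℚ - c) * fⱼ)
      ≡⟨ solve 2 (λ c f → c :* f :+ ((con 1ℚ :- c) :* f :+ (con 1ℚ :- c) :* f)
                          := (c :+ (con 1ℚ :+ con 1ℚ) :* (con 1ℚ :- c)) :* f) refl c fⱼ ⟩
    (c + (1ℚ + 1ℚ) * (1ℚ - c)) * fⱼ ∎
    where
    0≤1-c : 0ℚ ≤ 1ℚ - c
    0≤1-c = ≤-trans (≤-reflexive (sym (+-inverseʳ c))) (+-monoˡ-≤ (- c) c≤1)

    c*gₙ≤[1-c]*fⱼ : c * gₙ ≤ (1ℚ - c) * fⱼ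
    c*gₙ≤[1-c]*fⱼ = ≤-trans (c*y≤[1-c]*x c[gⱼ+gₙ]≤gⱼ) (*-monoˡ-≤-nonNeg (1ℚ - c) {{nonNegative 0≤1-c}} gⱼ≤fⱼ)

ℕ→ℚ-card≡containing+avoiding : (j : Fin n) (𝓕 : Family n) →
  ℕ→ℚ (card 𝓕) ≡ ℕ→ℚ (card (containing j 𝓕)) + ℕ→ℚ (card (avoiding j 𝓕))
ℕ→ℚ-card≡containing+avoiding j 𝓕 = trans (cong ℕ→ℚ (card≡containing+avoiding j 𝓕))
  (ℕ→ℚ-homo-+ (card (containing j 𝓕)) (card (avoiding j 𝓕)))

lemma1p1 : (n : ℕ) → n ≥ 2 → (𝓕 : Family n) → Unique 𝓕 →
    UnionClosed 𝓕 → CoversGround 𝓕 →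
    (i j : Fin n) → j ≢ i →
    (c : ℚ) → 0ℚ < c → c ≤ 1ℚ →
    c * ℕ→ℚ (card (removeElt i 𝓕)) ≤ ℕ→ℚ (card (containing j (removeElt i 𝓕))) →
    c * ℕ→ℚ (card 𝓕) ≤ (c + (1ℚ + 1ℚ) * (1ℚ - c)) * ℕ→ℚ (card (containing j 𝓕))
lemma1p1 n _ 𝓕 unique _ _ i j _ c 0<c c≤1 c|𝓖|≤|𝓖ⱼ| =
  subst (λ x → c * x ≤ (c + (1ℚ + 1ℚ) * (1ℚ - c)) * ℕ→ℚ (card (containing j 𝓕)))
    (sym (ℕ→ℚ-card≡containing+avoiding j 𝓕))
    (density-transfer (<⇒≤ 0<c) c≤1
      (≤-trans (ℕ→ℚ-mono-≤ (card-avoiding≤card-avoiding-removeElt-twice i j 𝓕 unique))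
               (≤-reflexive (ℕ→ℚ-homo-+ (card 𝓖ₙ) (card 𝓖ₙ))))
      (ℕ→ℚ-mono-≤ (card-containing-removeElt≤ i j 𝓕))
      (subst (λ x → c * x ≤ ℕ→ℚ (card (containing j 𝓖))) (ℕ→ℚ-card≡containing+avoiding j 𝓖) c|𝓖|≤|𝓖ⱼ|))
  where
  𝓖 𝓖ₙ : Family n
  𝓖  = removeElt i 𝓕
  𝓖ₙ = avoiding j 𝓖
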